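{- Let $D=(V,\Lambda)$ be a strongly connected digraph obtained by orienting a simple undirected graph $G$, let $v\in V$, and let $U$ be the set of vertices that two-reach $v$ in $D$. Then for every connected component $C$ of the subgraph of $G$ induced by $V\setminus U$, there is exactly one arc of $D$ with tail in $C$ and head in $U$.
   Context: A vertex $u$ two-reaches $v$ in a digraph if there are two arc-disjoint directed paths from $u$ to $v$; by convention $v$ two-reaches itself, so $v\in U$. "Component" means a connected component of the underlying undirected graph (not a strongly connected component). -}

module Defs where

open import Data.Nat using (ℕ)
open import Data.Fin using (Fin)
open import Data.Bool using (Bool; true; false; T)
open import Data.List using (List; []; _∷_)
open import Data.List.Membership.Propositional using (_∈_)
open import Data.List.Relation.Unary.Unique.Propositional using (Unique)
open import Data.Product using (Σ; ∃; _×_; _,_)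
open import Data.Sum using (_⊎_)
open import Data.Empty using (⊥)
open import Relation.Binary.PropositionalEquality using (_≡_)

record SimpleGraph (n : ℕ) : Set where
  field
    adj   : Fin n → Fin n → Bool
    sym   : ∀ x y → adj x y ≡ adj y x
    loopless : ∀ x → adj x x ≡ false

Digraph : ℕ → Set
Digraph n = Fin n → Fin n → Bool

IsOrientationOf : ∀ {n} → Digraph n → SimpleGraph n → Set
IsOrientationOf {n} D G =
  (∀ (x y : Fin n) → T (D x y) → T (SimpleGraph.adj G x y)) ×
  (∀ (x y : Fin n) → T (SimpleGraph.adj G x y) → T (D x y) ⊎ T (D y x)) ×
  (∀ (x y : Fin n) → T (D x y) → T (D y x) → ⊥)

data Walk {n : ℕ} (D : Digraph n) : Fin n → Fin n → Set where
  stop : ∀ {v} → Walk D v v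
  step : ∀ {u w v} → T (D u w) → Walk D w v → Walk D u v

verts : ∀ {n} {D : Digraph n} {u v} → Walk D u v → List (Fin n)
verts (stop {v}) = v ∷ []
verts (step {u} _ p) = u ∷ verts p

arcs : ∀ {n} {D : Digraph n} {u v} → Walk D u v → List (Fin n × Fin n)
arcs stop = []
arcs (step {u} {w} _ p) = (u , w) ∷ arcs p

IsPath : ∀ {n} {D : Digraph n} {u v} → Walk D u v → Set
IsPath p = Unique (verts p)

StronglyConnected : ∀ {n} → Digraph n → Set
StronglyConnected {n} D = ∀ (x y : Fin n) → Walk D x y

-- u two-reaches v: two arc-disjoint directed paths from u to v;
-- by convention v two-reaches itself.
TwoReaches : ∀ {n} → Digraph n → Fin n → Fin n → Set
TwoReaches {n} D u v =
  u ≡ v ⊎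
  Σ (Walk D u v) λ p → Σ (Walk D u v) λ q →
    IsPath p × IsPath q × (∀ (e : Fin n × Fin n) → e ∈ arcs p → e ∈ arcs q → ⊥)

data WalkIn {n : ℕ} (G : SimpleGraph n) (S : Fin n → Set) : Fin n → Fin n → Set where
  here  : ∀ {x} → S x → WalkIn G S x x
  there : ∀ {x y z} → S x → T (SimpleGraph.adj G x y) → WalkIn G S y z → WalkIn G S x z

IsComponent : ∀ {n} → SimpleGraph n → (Fin n → Set) → (Fin n → Set) → Set
IsComponent {n} G S C =
  (∀ x → C x → S x) ×
  (∃ λ x → C x) ×
  (∀ x y → C x → C y → WalkIn G S x y) ×
  (∀ x y → C x → S y → T (SimpleGraph.adj G x y) → C y)

-- A vertex y outside U has, by Menger's theorem for two arc-disjoint paths, a cut arc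
-- lying on every walk from y to v.  Call a walk from y that stays outside U until its
-- last arc, which enters U, an exit walk.  The cut arc of y lies on every exit walk
-- (after the walk enters U it can be continued to v along either of two arc-disjoint
-- paths), so all exit walks from y end in the same arc.  Along an edge of G between two
-- vertices outside U, the orientation lets an exit walk of one endpoint be prefixed by
-- that edge, so the exit arc is constant on each component C.  Every arc from C into U
-- is an exit walk by itself, which gives uniqueness; strong connectivity gives existence.
--
-- The two-path Menger theorem is proved by augmentation.  Given a path P from x to v,
-- either v is reachable from x in the residual digraph (arcs off P, and arcs of P
-- reversed) along some Q, and then P and Q with antiparallel pairs cancelled form an
-- arc set with out-degree minus in-degree 2·[w = x] − 2·[w = v], from which two
-- arc-disjoint walks are peeled off; or P leaves the set reached in the residual
-- digraph exactly once, and that arc lies on every walk from x to v.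

module Submission where

open import Defs
open import Data.Bool using (Bool; true; false; T; not; _∧_; _∨_; if_then_else_)
open import Data.Bool.Properties using (T-∧; ∨-zeroʳ; ∧-zeroʳ; ∧-identityʳ)
open import Data.Empty using (⊥; ⊥-elim)
open import Data.Fin using (Fin; _≟_; punchIn) renaming (zero to fzero; suc to fsuc)
open import Data.Fin.Properties using (any?; injective⇒≤; punchInᵢ≢i)
open import Data.List using (List; []; _∷_; length; lookup)
open import Data.List.Membership.Propositional using (_∈_; _∉_)
open import Data.List.Membership.Propositional.Properties using (∈-lookup)
import Data.List.Membership.DecPropositional as DecMembership
open import Data.List.Relation.Unary.All as All using (All; []; _∷_)
open import Data.List.Relation.Unary.All.Properties using (¬Any⇒All¬)
open import Data.List.Relation.Unary.AllPairs using ([]; _∷_)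
open import Data.List.Relation.Unary.Any using (here; there)
open import Data.List.Relation.Unary.Unique.Propositional using (Unique)
open import Data.Nat using (ℕ; zero; suc; _+_; _*_; _≤_; _<_; z≤n; s≤s)
open import Data.Nat.Properties
  using (≤-trans; ≤-refl; n≤1+n; m<n⇒m<1+n; suc-injective; 1+n≢0; m+n≡0⇒n≡0; +-assoc; +-comm;
         +-identityʳ; +-cancelˡ-≡; +-cancelʳ-≡; *-identityˡ; *-identityʳ; +-*-semiring)
open import Data.Nat.Solver using (module +-*-Solver)
open import Data.Product using (Σ; ∃; _×_; _,_; proj₁; proj₂)
open import Data.Product.Properties using (≡-dec)
open import Data.Sum using (_⊎_; inj₁; inj₂)
open import Function using (_∘_; id; Equivalence; mk⇔)
open import Relation.Nullary using (¬_; Dec; yes; no; does)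
open import Relation.Nullary.Decidable using (map′; _×-dec_; _⊎-dec_; T?; dec-true; dec-false; does-⇔)
open import Relation.Binary.PropositionalEquality
  using (_≡_; _≢_; refl; sym; trans; cong; cong₂; subst; module ≡-Reasoning)

open import Algebra.Properties.Semiring.Sum +-*-semiring
  using (sum; sum-syntax; ∑-distrib-+; sum-cong-≗; sum-replicate-zero; sum-remove;
         *-distribˡ-sum; *-distribʳ-sum)
open +-*-Solver using (solve; _:+_; _:=_)

Arc : ℕ → Set
Arc n = Fin n × Fin n

_≟ᵃ_ : ∀ {n} (e f : Arc n) → Dec (e ≡ f)
_≟ᵃ_ = ≡-dec _≟_ _≟_

module _ {n : ℕ} {D : Digraph n} where

  walkLength : ∀ {x y} → Walk D x y → ℕ
  walkLength stop = 0
  walkLength (step _ p) = suc (walkLength p)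

  _∷ʳ_ : ∀ {x a b} → Walk D x a → T (D a b) → Walk D x b
  stop ∷ʳ h = step h stop
  step h′ p ∷ʳ h = step h′ (p ∷ʳ h)

  ∈arcs⇒arc : ∀ {x y} (p : Walk D x y) {a b} → (a , b) ∈ arcs p → T (D a b)
  ∈arcs⇒arc (step h p) (here refl) = h
  ∈arcs⇒arc (step h p) (there e∈p) = ∈arcs⇒arc p e∈p

  ∈arcs⇒tail∈verts : ∀ {x y} (p : Walk D x y) {a b} → (a , b) ∈ arcs p → a ∈ verts p
  ∈arcs⇒tail∈verts (step h p) (here refl) = here refl
  ∈arcs⇒tail∈verts (step h p) (there e∈p) = there (∈arcs⇒tail∈verts p e∈p)

  SubPath : ∀ {x y} → Walk D x y → Set
  SubPath {x} {y} p = Σ (Walk D x y) λ q → IsPath q × (∀ {e} → e ∈ arcs q → e ∈ arcs p)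

  pathSuffix : ∀ {x z y} (p : Walk D x y) → z ∈ verts p → IsPath p →
    Σ (Walk D z y) λ q → IsPath q × (∀ {e} → e ∈ arcs q → e ∈ arcs p)
  pathSuffix stop (here refl) p-path = stop , p-path , λ e∈q → e∈q
  pathSuffix (step h p) (here refl) p-path = step h p , p-path , λ e∈q → e∈q
  pathSuffix (step h p) (there z∈p) (_ ∷ p-path) with pathSuffix p z∈p p-path
  ... | q , q-path , q⊆p = q , q-path , λ e∈q → there (q⊆p e∈q)

  toPath : ∀ {x y} (p : Walk D x y) → SubPath p
  toPath stop = stop , [] ∷ [] , λ e∈q → e∈q
  toPath {x} (step h p) with toPath p
  ... | q , q-path , q⊆p with DecMembership._∈?_ _≟_ x (verts q)
  ...   | yes x∈q = let r , r-path , r⊆q = pathSuffix q x∈q q-path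
                    in r , r-path , λ e∈r → there (q⊆p (r⊆q e∈r))
  ...   | no x∉q = step h q , ¬Any⇒All¬ (verts q) x∉q ∷ q-path ,
                   λ { (here refl) → here refl ; (there e∈q) → there (q⊆p e∈q) }

  path⇒uniqueArcs : ∀ {x y} (p : Walk D x y) → IsPath p → Unique (arcs p)
  path⇒uniqueArcs stop _ = []
  path⇒uniqueArcs (step h p) (x∉p ∷ p-path) =
    All.tabulate (λ { {a , b} e∈p refl → All.lookup x∉p (∈arcs⇒tail∈verts p e∈p) refl })
    ∷ path⇒uniqueArcs p p-path

  verts-length : ∀ {x y} (p : Walk D x y) → length (verts p) ≡ suc (walkLength p)
  verts-length stop = refl
  verts-length (step _ p) = cong suc (verts-length p)

disjointWalks⇒twoReaches : ∀ {n} {D : Digraph n} {x v} (W₁ W₂ : Walk D x v) →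
  (∀ e → e ∈ arcs W₁ → e ∈ arcs W₂ → ⊥) → TwoReaches D x v
disjointWalks⇒twoReaches W₁ W₂ disjoint with toPath W₁ | toPath W₂
... | p , p-path , p⊆W₁ | q , q-path , q⊆W₂ =
  inj₂ (p , q , p-path , q-path , λ e e∈p e∈q → disjoint e (p⊆W₁ e∈p) (q⊆W₂ e∈q))

unique-lookup-injective : ∀ {A : Set} (xs : List A) → Unique xs →
  ∀ i j → lookup xs i ≡ lookup xs j → i ≡ j
unique-lookup-injective (x ∷ xs) (x∉xs ∷ xs!) fzero    fzero    _  = refl
unique-lookup-injective (x ∷ xs) (x∉xs ∷ xs!) fzero    (fsuc j) eq = ⊥-elim (All.lookup x∉xs (∈-lookup j) eq)
unique-lookup-injective (x ∷ xs) (x∉xs ∷ xs!) (fsuc i) fzero    eq = ⊥-elim (All.lookup x∉xs (∈-lookup i) (sym eq))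
unique-lookup-injective (x ∷ xs) (x∉xs ∷ xs!) (fsuc i) (fsuc j) eq =
  cong fsuc (unique-lookup-injective xs xs! i j eq)

unique-length≤ : ∀ {n} (xs : List (Fin n)) → Unique xs → length xs ≤ n
unique-length≤ xs xs! = injective⇒≤ (λ {i} {j} → unique-lookup-injective xs xs! i j)

module _ {n : ℕ} (D : Digraph n) where

  walkWithin? : ∀ k x y → Dec (Σ (Walk D x y) λ p → walkLength p ≤ k)
  walkWithin? zero x y = map′ (λ { refl → stop , z≤n }) (λ { (stop , _) → refl }) (x ≟ y)
  walkWithin? (suc k) x y =
    map′ (λ { (inj₁ refl) → stop , z≤n ; (inj₂ (w , h , p , p≤k)) → step h p , s≤s p≤k })
         (λ { (stop , _) → inj₁ refl ; (step h p , s≤s p≤k) → inj₂ (_ , h , p , p≤k) })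
         (x ≟ y ⊎-dec any? (λ w → T? (D x w) ×-dec walkWithin? k w y))

  walk? : ∀ x y → Dec (Walk D x y)
  walk? x y = map′ proj₁ shortWalk (walkWithin? n x y)
    where
    shortWalk : Walk D x y → Σ (Walk D x y) λ p → walkLength p ≤ n
    shortWalk p with toPath p
    ... | q , q-path , _ =
      q , ≤-trans (n≤1+n _) (subst (_≤ n) (verts-length q) (unique-length≤ (verts q) q-path))

-- Degrees of arc sets

⟦_⟧ : Bool → ℕ
⟦ b ⟧ = if b then 1 else 0

⟦⟧-true : ∀ {b} → T b → ⟦ b ⟧ ≡ 1
⟦⟧-true {true} _ = refl

⟦⟧-false : ∀ {b} → ¬ T b → ⟦ b ⟧ ≡ 0
⟦⟧-false {false} _ = refl
⟦⟧-false {true} ¬t = ⊥-elim (¬t _)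

sum-zero : ∀ {n} (f : Fin n → ℕ) → (∀ y → f y ≡ 0) → sum f ≡ 0
sum-zero {n} f f≗0 = trans (sum-cong-≗ f≗0) (sum-replicate-zero n)

module _ {n : ℕ} where

  δ : Fin n → Fin n → ℕ
  δ a b = ⟦ does (a ≟ b) ⟧

  δ-refl : ∀ a → δ a a ≡ 1
  δ-refl a = cong ⟦_⟧ (dec-true (a ≟ a) refl)

  δ-≢ : ∀ {a b} → a ≢ b → δ a b ≡ 0
  δ-≢ {a} {b} a≢b = cong ⟦_⟧ (dec-false (a ≟ b) a≢b)

δ*δ-≢ : ∀ {n} {a b c d : Fin n} → (a , b) ≢ (c , d) → δ a c * δ b d ≡ 0
δ*δ-≢ {a = a} {b} {c} {d} ab≢cd with a ≟ c | b ≟ d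
... | yes refl | yes refl = ⊥-elim (ab≢cd refl)
... | yes _    | no _     = refl
... | no _     | _        = refl

∑-δ : ∀ {n} (d : Fin n) → ∑[ y < n ] (δ y d) ≡ 1
∑-δ {suc m} d = begin
  ∑[ y < suc m ] (δ y d)                  ≡⟨ sum-remove {i = d} (λ y → δ y d) ⟩
  δ d d + ∑[ j < m ] (δ (punchIn d j) d)  ≡⟨ cong₂ _+_ (δ-refl d) (sum-zero _ λ j → δ-≢ (punchInᵢ≢i d j)) ⟩
  1                                       ∎
  where open ≡-Reasoning

module _ {n : ℕ} where

  outdeg : Digraph n → Fin n → ℕ
  outdeg M w = ∑[ y < n ] ⟦ M w y ⟧

  indeg : Digraph n → Fin n → ℕ
  indeg M w = ∑[ y < n ] ⟦ M y w ⟧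

  arcCount : Digraph n → ℕ
  arcCount M = sum (outdeg M)

  Balanced : Digraph n → (Fin n → ℕ) → (Fin n → ℕ) → Set
  Balanced M A B = ∀ w → outdeg M w + A w ≡ indeg M w + B w

  _⊆ᴰ_ : Digraph n → Digraph n → Set
  M ⊆ᴰ M′ = ∀ a b → T (M a b) → T (M′ a b)

  outdeg≢0⇒outArc : ∀ (M : Digraph n) w → outdeg M w ≢ 0 → ∃ λ d → T (M w d)
  outdeg≢0⇒outArc M w outdeg≢0 with any? (λ d → T? (M w d))
  ... | yes found = found
  ... | no none = ⊥-elim (outdeg≢0 (sum-zero _ (λ d → ⟦⟧-false (none ∘ (d ,_)))))

  AddsArc : Digraph n → Arc n → Digraph n → Set
  AddsArc M′ (c , d) M = ∀ a b → ⟦ M a b ⟧ ≡ δ a c * δ b d + ⟦ M′ a b ⟧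

  module _ {M′ M : Digraph n} {c d : Fin n} (M=M′+cd : AddsArc M′ (c , d) M) where
    open ≡-Reasoning

    outdeg-addsArc : ∀ w → outdeg M w ≡ δ w c + outdeg M′ w
    outdeg-addsArc w = begin
      outdeg M w                                ≡⟨ sum-cong-≗ (M=M′+cd w) ⟩
      ∑[ y < n ] (δ w c * δ y d + ⟦ M′ w y ⟧)   ≡⟨ ∑-distrib-+ (λ y → δ w c * δ y d) _ ⟩
      ∑[ y < n ] (δ w c * δ y d) + outdeg M′ w  ≡⟨ cong (_+ _) (*-distribˡ-sum {n} (δ w c) _) ⟨
      δ w c * ∑[ y < n ] (δ y d) + outdeg M′ w  ≡⟨ cong (λ s → δ w c * s + _) (∑-δ d) ⟩
      δ w c * 1 + outdeg M′ w                   ≡⟨ cong (_+ _) (*-identityʳ (δ w c)) ⟩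
      δ w c + outdeg M′ w                       ∎

    indeg-addsArc : ∀ w → indeg M w ≡ δ w d + indeg M′ w
    indeg-addsArc w = begin
      indeg M w                                 ≡⟨ sum-cong-≗ (λ y → M=M′+cd y w) ⟩
      ∑[ y < n ] (δ y c * δ w d + ⟦ M′ y w ⟧)   ≡⟨ ∑-distrib-+ (λ y → δ y c * δ w d) _ ⟩
      ∑[ y < n ] (δ y c * δ w d) + indeg M′ w   ≡⟨ cong (_+ _) (*-distribʳ-sum {n} (δ w d) _) ⟨
      ∑[ y < n ] (δ y c) * δ w d + indeg M′ w   ≡⟨ cong (λ s → s * δ w d + _) (∑-δ c) ⟩
      1 * δ w d + indeg M′ w                    ≡⟨ cong (_+ _) (*-identityˡ (δ w d)) ⟩
      δ w d + indeg M′ w                        ∎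

    arcCount-addsArc : arcCount M ≡ suc (arcCount M′)
    arcCount-addsArc = begin
      arcCount M                                ≡⟨ sum-cong-≗ outdeg-addsArc ⟩
      ∑[ w < n ] (δ w c + outdeg M′ w)          ≡⟨ ∑-distrib-+ (λ w → δ w c) _ ⟩
      ∑[ w < n ] (δ w c) + arcCount M′          ≡⟨ cong (_+ arcCount M′) (∑-δ c) ⟩
      suc (arcCount M′)                         ∎

  removeArc : Digraph n → Arc n → Digraph n
  removeArc M (c , d) a b = M a b ∧ not (does (a ≟ c) ∧ does (b ≟ d))

  removeArc-⊆ : ∀ M e → removeArc M e ⊆ᴰ M
  removeArc-⊆ M e a b = proj₁ ∘ Equivalence.to T-∧

  removeArc-removes : ∀ M c d → ¬ T (removeArc M (c , d) c d)
  removeArc-removes M c d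
    rewrite dec-true (c ≟ c) refl | dec-true (d ≟ d) refl | ∧-zeroʳ (M c d) = id

  removeArc-addsArc : ∀ M c d → T (M c d) → AddsArc (removeArc M (c , d)) (c , d) M
  removeArc-addsArc M c d cd∈M a b with a ≟ c | b ≟ d
  ... | yes refl | yes refl rewrite ∧-zeroʳ (M a b) = ⟦⟧-true cd∈M
  ... | yes refl | no _     rewrite ∧-identityʳ (M a b) = refl
  ... | no _     | _        rewrite ∧-identityʳ (M a b) = refl

_∈ᵃ?_ : ∀ {n} (e : Arc n) (es : List (Arc n)) → Dec (e ∈ es)
_∈ᵃ?_ = DecMembership._∈?_ _≟ᵃ_

∈ᵃ?-∷-≢ : ∀ {n} {e f : Arc n} {es} → e ≢ f → does (e ∈ᵃ? (f ∷ es)) ≡ does (e ∈ᵃ? es)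
∈ᵃ?-∷-≢ {e = e} {f} {es} e≢f =
  does-⇔ (mk⇔ (λ { (here e≡f) → ⊥-elim (e≢f e≡f) ; (there e∈es) → e∈es }) there)
    (e ∈ᵃ? (f ∷ es)) (e ∈ᵃ? es)

module _ {n : ℕ} {D : Digraph n} where

  arcSet : ∀ {x y} → Walk D x y → Digraph n
  arcSet p a b = does ((a , b) ∈ᵃ? arcs p)

  arcSet⇒∈ : ∀ {x y} (p : Walk D x y) {a b} → T (arcSet p a b) → (a , b) ∈ arcs p
  arcSet⇒∈ p {a} {b} ab∈M with (a , b) ∈ᵃ? arcs p
  ... | yes ab∈p = ab∈p

  ∈⇒arcSet : ∀ {x y} (p : Walk D x y) {a b} → (a , b) ∈ arcs p → T (arcSet p a b)
  ∈⇒arcSet p {a} {b} ab∈p rewrite dec-true ((a , b) ∈ᵃ? arcs p) ab∈p = _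

  arcSet-step : ∀ {x w y} (h : T (D x w)) (p : Walk D w y) → (x , w) ∉ arcs p →
    AddsArc (arcSet p) (x , w) (arcSet (step h p))
  arcSet-step {x} {w} h p xw∉p a b = byCases ((a , b) ≟ᵃ (x , w))
    where
    byCases : Dec ((a , b) ≡ (x , w)) → ⟦ arcSet (step h p) a b ⟧ ≡ δ a x * δ b w + ⟦ arcSet p a b ⟧
    byCases (yes refl) = trans (cong ⟦_⟧ (dec-true ((x , w) ∈ᵃ? arcs (step h p)) (here refl)))
      (sym (cong₂ _+_ (cong₂ _*_ (δ-refl x) (δ-refl w)) (cong ⟦_⟧ (dec-false ((x , w) ∈ᵃ? arcs p) xw∉p))))
    byCases (no ab≢xw) =
      trans (cong ⟦_⟧ (∈ᵃ?-∷-≢ {es = arcs p} ab≢xw)) (cong (_+ ⟦ arcSet p a b ⟧) (sym (δ*δ-≢ ab≢xw)))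

  arcSet-balanced : ∀ {s t} (p : Walk D s t) → Unique (arcs p) →
    Balanced (arcSet p) (λ w → δ w t) (λ w → δ w s)
  arcSet-balanced stop _ w = refl
  arcSet-balanced {s} {t} (step {w = u} h p) (su≢p ∷ p!) w = begin
    outdeg (arcSet (step h p)) w + δ w t      ≡⟨ cong (_+ δ w t) (outdeg-addsArc su+p w) ⟩
    δ w s + outdeg (arcSet p) w + δ w t       ≡⟨ +-assoc (δ w s) _ _ ⟩
    δ w s + (outdeg (arcSet p) w + δ w t)     ≡⟨ cong (δ w s +_) (arcSet-balanced p p! w) ⟩
    δ w s + (indeg (arcSet p) w + δ w u)      ≡⟨ +-comm (δ w s) _ ⟩
    indeg (arcSet p) w + δ w u + δ w s        ≡⟨ cong (_+ δ w s) (+-comm (indeg (arcSet p) w) _) ⟩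
    δ w u + indeg (arcSet p) w + δ w s        ≡⟨ cong (_+ δ w s) (indeg-addsArc su+p w) ⟨
    indeg (arcSet (step h p)) w + δ w s       ∎
    where
    open ≡-Reasoning
    su+p : AddsArc (arcSet p) (s , u) (arcSet (step h p))
    su+p = arcSet-step h p (λ su∈p → All.lookup su≢p su∈p refl)

-- Peeling walks off a balanced arc set

cancelMiddle : ∀ o a x i b → o + (a + x) ≡ i + (b + x) → o + a ≡ i + b
cancelMiddle o a x i b eq = +-cancelʳ-≡ x _ _ (begin
  o + a + x          ≡⟨ +-assoc o a x ⟩
  o + (a + x)        ≡⟨ eq ⟩
  i + (b + x)        ≡⟨ +-assoc i b x ⟨
  i + b + x          ∎)
  where open ≡-Reasoning

shiftStart : ∀ x o a i b d → x + o + a ≡ d + i + (b + x) → o + a ≡ i + (b + d)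
shiftStart x o a i b d eq = +-cancelˡ-≡ x _ _ (begin
  x + (o + a)        ≡⟨ +-assoc x o a ⟨
  x + o + a          ≡⟨ eq ⟩
  d + i + (b + x)    ≡⟨ solve 4 (λ x i b d → d :+ i :+ (b :+ x) := x :+ (i :+ (b :+ d))) refl x i b d ⟩
  x + (i + (b + d))  ∎)
  where open ≡-Reasoning

record WalkDecomposition {n} (D M : Digraph n) (A B : Fin n → ℕ) (c t : Fin n) : Set where
  field
    walk          : Walk D c t
    rest          : Digraph n
    rest-balanced : Balanced rest A B
    rest-⊆        : rest ⊆ᴰ M
    walk-⊆        : ∀ {a b} → (a , b) ∈ arcs walk → T (M a b)
    walk-∉rest    : ∀ {a b} → (a , b) ∈ arcs walk → ¬ T (rest a b)

module _ {n : ℕ} {D : Digraph n} where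

  decomposition-stop : ∀ {M : Digraph n} {A B : Fin n → ℕ} {t : Fin n} →
    Balanced M (λ w → A w + δ w t) (λ w → B w + δ w t) →
    WalkDecomposition D M A B t t
  decomposition-stop {M} {A} {B} {t} bal = record
    { walk = stop ; rest = M
    ; rest-balanced = λ w → cancelMiddle (outdeg M w) (A w) (δ w t) (indeg M w) (B w) (bal w)
    ; rest-⊆ = λ _ _ → id ; walk-⊆ = λ () ; walk-∉rest = λ () }

  decomposition-step : ∀ {M : Digraph n} {A B : Fin n → ℕ} {c d t : Fin n} → T (D c d) → T (M c d) →
    WalkDecomposition D (removeArc M (c , d)) A B d t → WalkDecomposition D M A B c t
  decomposition-step {M} {c = c} {d} cd∈D cd∈M dec = record
    { walk = step cd∈D walk ; rest = rest ; rest-balanced = rest-balanced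
    ; rest-⊆ = λ a b → removeArc-⊆ M (c , d) a b ∘ rest-⊆ a b
    ; walk-⊆ = λ { (here refl) → cd∈M ; (there ab∈W) → removeArc-⊆ M (c , d) _ _ (walk-⊆ ab∈W) }
    ; walk-∉rest = λ { (here refl) → removeArc-removes M c d ∘ rest-⊆ c d
                     ; (there ab∈W) → walk-∉rest ab∈W } }
    where open WalkDecomposition dec

  removeArc-balanced : ∀ {M : Digraph n} {A B : Fin n → ℕ} {c d t : Fin n} → T (M c d) →
    Balanced M (λ w → A w + δ w t) (λ w → B w + δ w c) →
    Balanced (removeArc M (c , d)) (λ w → A w + δ w t) (λ w → B w + δ w d)
  removeArc-balanced {M} {A} {B} {c} {d} {t} cd∈M bal w =
    shiftStart (δ w c) (outdeg M′ w) (A w + δ w t) (indeg M′ w) (B w) (δ w d) (begin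
    δ w c + outdeg M′ w + (A w + δ w t)    ≡⟨ cong (_+ (A w + δ w t)) (outdeg-addsArc M=M′+cd w) ⟨
    outdeg M w + (A w + δ w t)             ≡⟨ bal w ⟩
    indeg M w + (B w + δ w c)              ≡⟨ cong (_+ (B w + δ w c)) (indeg-addsArc M=M′+cd w) ⟩
    δ w d + indeg M′ w + (B w + δ w c)     ∎)
    where
    open ≡-Reasoning
    M′ = removeArc M (c , d)
    M=M′+cd = removeArc-addsArc M c d cd∈M

  -- Each step leaves the current vertex c ≠ t along an arc of M, which exists because
  -- the balance at c forces a positive out-degree there.
  private
    peel : ∀ k {M : Digraph n} {A B : Fin n → ℕ} {c t : Fin n} → arcCount M ≡ k →
      (∀ w → w ≢ t → A w ≡ 0) → M ⊆ᴰ D →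
      Balanced M (λ w → A w + δ w t) (λ w → B w + δ w c) → WalkDecomposition D M A B c t
    peel k {M} {A} {B} {c} {t} size A|t M⊆D bal with c ≟ t
    ... | yes refl = decomposition-stop bal
    ... | no c≢t with outdeg≢0⇒outArc M c outdeg≢0
      where
      outdeg≢0 : outdeg M c ≢ 0
      outdeg≢0 outdeg≡0 = 1+n≢0 (m+n≡0⇒n≡0 (B c) (m+n≡0⇒n≡0 (indeg M c) (begin
        indeg M c + (B c + 1)            ≡⟨ cong (λ z → indeg M c + (B c + z)) (δ-refl c) ⟨
        indeg M c + (B c + δ c c)        ≡⟨ bal c ⟨
        outdeg M c + (A c + δ c t)       ≡⟨ cong₂ _+_ outdeg≡0 (cong₂ _+_ (A|t c c≢t) (δ-≢ c≢t)) ⟩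
        0                                ∎)))
        where open ≡-Reasoning
    ... | d , cd∈M with k
    ...   | zero = ⊥-elim (1+n≢0 (trans (sym (arcCount-addsArc (removeArc-addsArc M c d cd∈M))) size))
    ...   | suc k = decomposition-step (M⊆D c d cd∈M) cd∈M
        (peel k (suc-injective (trans (sym (arcCount-addsArc (removeArc-addsArc M c d cd∈M))) size)) A|t
          (λ a b → M⊆D a b ∘ removeArc-⊆ M (c , d) a b) (removeArc-balanced cd∈M bal))

  balanced⇒walkDecomposition : ∀ {M : Digraph n} {A B : Fin n → ℕ} {c t : Fin n} →
    (∀ w → w ≢ t → A w ≡ 0) → M ⊆ᴰ D →
    Balanced M (λ w → A w + δ w t) (λ w → B w + δ w c) → WalkDecomposition D M A B c t
  balanced⇒walkDecomposition {M} = peel (arcCount M) refl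

-- Two arc-disjoint paths or a cut arc

CutArc : ∀ {n} → Digraph n → Fin n → Fin n → Set
CutArc {n} D x v = Σ (Arc n) λ e → ∀ (W : Walk D x v) → e ∈ arcs W

cutArc⇒¬twoReaches : ∀ {n} {D : Digraph n} {x v} → CutArc D x v → ¬ TwoReaches D x v
cutArc⇒¬twoReaches (e , e∈) (inj₁ refl) with e∈ stop
... | ()
cutArc⇒¬twoReaches (e , e∈) (inj₂ (p , q , _ , _ , disjoint)) = disjoint e (e∈ p) (e∈ q)

residual-forward : ∀ d p p′ → T d → ¬ T p → T ((d ∧ not p) ∨ p′)
residual-forward true false p′ _ _ = _
residual-forward true true p′ _ ¬p = ⊥-elim (¬p _)

residual-backward : ∀ d p p′ → T p′ → T ((d ∧ not p) ∨ p′)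
residual-backward d p true _ rewrite ∨-zeroʳ (d ∧ not p) = _

residual-forward⁻ : ∀ d p p′ → T ((d ∧ not p) ∨ p′) → ¬ T p′ → T d × ¬ T p
residual-forward⁻ true false false _ _ = _ , id
residual-forward⁻ d p true _ ¬p′ = ⊥-elim (¬p′ _)

combined-cases : ∀ p q p′ q′ → T ((p ∧ not q′) ∨ (q ∧ not p′)) → T p ⊎ (T q × ¬ T p′)
combined-cases true  _     _     _ _ = inj₁ _
combined-cases false true  false _ _ = inj₂ (_ , id)

cancellation-count : ∀ p p′ q q′ → (T q → ¬ T p′ → ¬ T p) →
  ⟦ (p ∧ not q′) ∨ (q ∧ not p′) ⟧ + ⟦ q′ ∧ p ⟧ ≡ ⟦ p ⟧ + ⟦ q ∧ not p′ ⟧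
cancellation-count true  true  q     false _ rewrite ∧-zeroʳ q = refl
cancellation-count true  false true  false c = ⊥-elim (c _ id _)
cancellation-count true  false false false _ = refl
cancellation-count true  _     _     true  _ = +-comm _ 1
cancellation-count false _     _     true  _ = +-identityʳ _
cancellation-count false _     _     false _ = +-identityʳ _

split-count : ∀ q p → ⟦ q ∧ not p ⟧ + ⟦ q ∧ p ⟧ ≡ ⟦ q ⟧
split-count true  true  = refl
split-count true  false = refl
split-count false _     = refl

augmentation-arith : ∀ {oF iF oR iR oP iP oQ iQ oG iG dv dx} →
  oF + oR ≡ oP + oG → iF + iR ≡ iP + iG → oG + iR ≡ oQ → iG + oR ≡ iQ →
  oP + dv ≡ iP + dx → oQ + dv ≡ iQ + dx → oF + (dv + dv) ≡ iF + (dx + dx)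
augmentation-arith {oF} {iF} {oR} {iR} {oP} {iP} {oQ} {iQ} {oG} {iG} {dv} {dx} eF eF′ eG eG′ eP eQ =
  +-cancelʳ-≡ (oR + iR) _ _ (trans lhs (sym rhs))
  where
  open ≡-Reasoning
  lhs : oF + (dv + dv) + (oR + iR) ≡ (iP + dx) + (iQ + dx)
  lhs = begin
    oF + (dv + dv) + (oR + iR)
      ≡⟨ solve 4 (λ f d r i → f :+ (d :+ d) :+ (r :+ i) := (f :+ r) :+ (i :+ (d :+ d))) refl oF dv oR iR ⟩
    (oF + oR) + (iR + (dv + dv))  ≡⟨ cong (_+ (iR + (dv + dv))) eF ⟩
    (oP + oG) + (iR + (dv + dv))
      ≡⟨ solve 4 (λ p g i d → (p :+ g) :+ (i :+ (d :+ d)) := (p :+ d) :+ ((g :+ i) :+ d)) refl oP oG iR dv ⟩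
    (oP + dv) + ((oG + iR) + dv)  ≡⟨ cong₂ _+_ eP (cong (_+ dv) eG) ⟩
    (iP + dx) + (oQ + dv)         ≡⟨ cong ((iP + dx) +_) eQ ⟩
    (iP + dx) + (iQ + dx)         ∎
  rhs : iF + (dx + dx) + (oR + iR) ≡ (iP + dx) + (iQ + dx)
  rhs = begin
    iF + (dx + dx) + (oR + iR)
      ≡⟨ solve 4 (λ f d r i → f :+ (d :+ d) :+ (r :+ i) := (f :+ i) :+ (r :+ (d :+ d))) refl iF dx oR iR ⟩
    (iF + iR) + (oR + (dx + dx))  ≡⟨ cong (_+ (oR + (dx + dx))) eF′ ⟩
    (iP + iG) + (oR + (dx + dx))
      ≡⟨ solve 4 (λ p g r d → (p :+ g) :+ (r :+ (d :+ d)) := (p :+ d) :+ ((g :+ r) :+ d)) refl iP iG oR dx ⟩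
    (iP + dx) + ((iG + oR) + dx)  ≡⟨ cong (λ z → (iP + dx) + (z + dx)) eG′ ⟩
    (iP + dx) + (iQ + dx)         ∎

module Augmentation {n : ℕ} (D : Digraph n) {x v : Fin n} (P : Walk D x v) where

  residual : Digraph n
  residual a b = (D a b ∧ not (arcSet P a b)) ∨ arcSet P b a

  Reached : Fin n → Set
  Reached = Walk residual x

  Leaves : Arc n → Set
  Leaves (c , d) = Reached c × ¬ Reached d

  reached-forward : ∀ {a b} → T (D a b) → (a , b) ∉ arcs P → Reached a → Reached b
  reached-forward ab∈D ab∉P ra =
    ra ∷ʳ residual-forward (D _ _) (arcSet P _ _) _ ab∈D (ab∉P ∘ arcSet⇒∈ P)

  reached-backward : ∀ {a b} → (a , b) ∈ arcs P → Reached b → Reached a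
  reached-backward ab∈P rb = rb ∷ʳ residual-backward (D _ _) (arcSet P _ _) _ (∈⇒arcSet P ab∈P)

  unreached-onwards : ∀ {a b} (p : Walk D a b) → (∀ {e} → e ∈ arcs p → e ∈ arcs P) → ¬ Reached a →
    ∀ {c d} → (c , d) ∈ arcs p → ¬ Reached c
  unreached-onwards (step h p) p⊆P ¬ra (here refl) = ¬ra
  unreached-onwards (step h p) p⊆P ¬ra (there cd∈p) =
    unreached-onwards p (p⊆P ∘ there) (¬ra ∘ reached-backward (p⊆P (here refl))) cd∈p

  leaving-unique : ∀ {a b} (p : Walk D a b) → (∀ {e} → e ∈ arcs p → e ∈ arcs P) →
    Reached a → ¬ Reached b →
    Σ (Arc n) λ e → ∀ {f} → f ∈ arcs p → Leaves f → f ≡ e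
  leaving-unique stop _ ra ¬rb = ⊥-elim (¬rb ra)
  leaving-unique (step {u = a} {w = w} h p) p⊆P ra ¬rb with walk? residual x w
  ... | no ¬rw = (a , w) , λ
    { (here refl) _ → refl
    ; (there f∈p) (rf , _) → ⊥-elim (unreached-onwards p (p⊆P ∘ there) ¬rw f∈p rf) }
  ... | yes rw with leaving-unique p (p⊆P ∘ there) rw ¬rb
  ...   | e , unique = e , λ
    { (here refl) (_ , ¬rw) → ⊥-elim (¬rw rw)
    ; (there f∈p) leaves → unique f∈p leaves }

  walk-leaves : ∀ {a b} (W : Walk D a b) → Reached a → ¬ Reached b →
    Σ (Arc n) λ f → f ∈ arcs W × Leaves f
  walk-leaves stop ra ¬rb = ⊥-elim (¬rb ra)
  walk-leaves (step {u = a} {w = w} h W) ra ¬rb with walk? residual x w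
  ... | no ¬rw = (a , w) , here refl , ra , ¬rw
  ... | yes rw with walk-leaves W rw ¬rb
  ...   | f , f∈W , leaves = f , there f∈W , leaves

  -- A walk leaves the reached set only along an arc of P, and P itself leaves it only once.
  unreached⇒cutArc : ¬ Reached v → CutArc D x v
  unreached⇒cutArc ¬rv with leaving-unique P id stop ¬rv
  ... | e , unique = e , λ W → onEveryWalk W (walk-leaves W stop ¬rv)
    where
    onEveryWalk : (W : Walk D x v) → Σ (Arc n) (λ f → f ∈ arcs W × Leaves f) → e ∈ arcs W
    onEveryWalk W ((c , d) , cd∈W , rc , ¬rd) with (c , d) ∈ᵃ? arcs P
    ... | yes cd∈P = subst (_∈ arcs W) (unique cd∈P (rc , ¬rd)) cd∈W
    ... | no cd∉P = ⊥-elim (¬rd (reached-forward (∈arcs⇒arc W cd∈W) cd∉P rc))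

  module _ (P! : Unique (arcs P)) (Q : Walk residual x v) (Q! : Unique (arcs Q)) where
    private
      Pᴹ Qᴹ : Digraph n
      Pᴹ = arcSet P
      Qᴹ = arcSet Q

    -- An arc of P that Q traverses backwards is cancelled from both.
    combined cancelled forwardQ : Digraph n
    combined a b = (Pᴹ a b ∧ not (Qᴹ b a)) ∨ (Qᴹ a b ∧ not (Pᴹ b a))
    cancelled a b = Qᴹ b a ∧ Pᴹ a b
    forwardQ a b = Qᴹ a b ∧ not (Pᴹ b a)

    private
      Q-forward : ∀ {a b} → T (Qᴹ a b) → ¬ T (Pᴹ b a) → T (D a b) × ¬ T (Pᴹ a b)
      Q-forward ab∈Q = residual-forward⁻ (D _ _) (Pᴹ _ _) (Pᴹ _ _) (∈arcs⇒arc Q (arcSet⇒∈ Q ab∈Q))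

    combined-⊆ : combined ⊆ᴰ D
    combined-⊆ a b ab∈F with combined-cases (Pᴹ a b) (Qᴹ a b) (Pᴹ b a) (Qᴹ b a) ab∈F
    ... | inj₁ ab∈P = ∈arcs⇒arc P (arcSet⇒∈ P ab∈P)
    ... | inj₂ (ab∈Q , ba∉P) = proj₁ (Q-forward ab∈Q ba∉P)

    private
      ¬Pᴹ-reverse : ∀ {a b} → T (Qᴹ a b) → ¬ T (Pᴹ b a) → ¬ T (Pᴹ a b)
      ¬Pᴹ-reverse ab∈Q ba∉P = proj₂ (Q-forward ab∈Q ba∉P)

      outdeg-combined : ∀ w → outdeg combined w + outdeg cancelled w ≡ outdeg Pᴹ w + outdeg forwardQ w
      outdeg-combined w = trans (sym (∑-distrib-+ {n} _ _)) (trans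
        (sum-cong-≗ {n} (λ y → cancellation-count (Pᴹ w y) (Pᴹ y w) (Qᴹ w y) (Qᴹ y w) ¬Pᴹ-reverse))
        (∑-distrib-+ {n} _ _))

      indeg-combined : ∀ w → indeg combined w + indeg cancelled w ≡ indeg Pᴹ w + indeg forwardQ w
      indeg-combined w = trans (sym (∑-distrib-+ {n} _ _)) (trans
        (sum-cong-≗ {n} (λ y → cancellation-count (Pᴹ y w) (Pᴹ w y) (Qᴹ y w) (Qᴹ w y) ¬Pᴹ-reverse))
        (∑-distrib-+ {n} _ _))

      outdeg-forwardQ : ∀ w → outdeg forwardQ w + indeg cancelled w ≡ outdeg Qᴹ w
      outdeg-forwardQ w =
        trans (sym (∑-distrib-+ {n} _ _)) (sum-cong-≗ {n} (λ y → split-count (Qᴹ w y) (Pᴹ y w)))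

      indeg-forwardQ : ∀ w → indeg forwardQ w + outdeg cancelled w ≡ indeg Qᴹ w
      indeg-forwardQ w =
        trans (sym (∑-distrib-+ {n} _ _)) (sum-cong-≗ {n} (λ y → split-count (Qᴹ y w) (Pᴹ w y)))

    combined-balanced : Balanced combined (λ w → δ w v + δ w v) (λ w → δ w x + δ w x)
    combined-balanced w = augmentation-arith (outdeg-combined w) (indeg-combined w) (outdeg-forwardQ w)
      (indeg-forwardQ w) (arcSet-balanced P P! w) (arcSet-balanced Q Q! w)

    private
      open WalkDecomposition

      first : WalkDecomposition D combined (λ w → δ w v) (λ w → δ w x) x v
      first = balanced⇒walkDecomposition (λ _ → δ-≢) combined-⊆ combined-balanced

      second : WalkDecomposition D (rest first) (λ _ → 0) (λ _ → 0) x v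
      second = balanced⇒walkDecomposition (λ _ _ → refl) (λ a b → combined-⊆ a b ∘ rest-⊆ first a b)
        (rest-balanced first)

    augmentation⇒twoReaches : TwoReaches D x v
    augmentation⇒twoReaches = disjointWalks⇒twoReaches (walk first) (walk second)
      λ { (a , b) ab∈first ab∈second → walk-∉rest first ab∈first (walk-⊆ second ab∈second) }

twoReaches⊎cutArc : ∀ {n} (D : Digraph n) {x v} → Walk D x v → TwoReaches D x v ⊎ CutArc D x v
twoReaches⊎cutArc D {x} {v} W with toPath W
... | P , P-path , _ with walk? (Augmentation.residual D P) x v
...   | no ¬reached = inj₂ (Augmentation.unreached⇒cutArc D P ¬reached)
...   | yes Q₀ with toPath Q₀
...     | Q , Q-path , _ = inj₁ (Augmentation.augmentation⇒twoReaches D P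
          (path⇒uniqueArcs P P-path) Q (path⇒uniqueArcs Q Q-path))

-- Exit arcs of the components

walkIn-start : ∀ {n} {G : SimpleGraph n} {S : Fin n → Set} {x y} → WalkIn G S x y → S x
walkIn-start (here s) = s
walkIn-start (there s _ _) = s

module ExitArcs {n : ℕ} {D : Digraph n} (strong : StronglyConnected D) (v : Fin n) where

  TwoReacher : Fin n → Set
  TwoReacher x = TwoReaches D x v

  -- The start vertex itself is not required to lie outside U.
  data ExitWalk : Fin n → Arc n → Set where
    exit : ∀ {y b} → T (D y b) → TwoReacher b → ExitWalk y (y , b)
    cont : ∀ {y w e} → T (D y w) → ¬ TwoReacher w → ExitWalk w e → ExitWalk y e

  exitLength : ∀ {y e} → ExitWalk y e → ℕ
  exitLength (exit _ _) = 0
  exitLength (cont _ _ ew) = suc (exitLength ew)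

  exitWalk-arc : ∀ {y a b} → ExitWalk y (a , b) → T (D a b)
  exitWalk-arc (exit ab∈D _) = ab∈D
  exitWalk-arc (cont _ _ ew) = exitWalk-arc ew

  exitWalk-head : ∀ {y a b} → ExitWalk y (a , b) → TwoReacher b
  exitWalk-head (exit _ b∈U) = b∈U
  exitWalk-head (cont _ _ ew) = exitWalk-head ew

  toExitWalk : ∀ {x} → Walk D x v → ¬ TwoReacher x → ∃ (ExitWalk x)
  toExitWalk stop ¬v = ⊥-elim (¬v (inj₁ refl))
  toExitWalk (step {w = w} xw∈D W) _ with twoReaches⊎cutArc D (strong w v)
  ... | inj₁ w∈U = _ , exit xw∈D w∈U
  ... | inj₂ cut = let e , ew = toExitWalk W (cutArc⇒¬twoReaches cut) in
                   e , cont xw∈D (cutArc⇒¬twoReaches cut) ew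

  cutArc-on-exitWalk : ∀ {y e} (ew : ExitWalk y e) (c : Arc n) → (∀ (W : Walk D y v) → c ∈ arcs W) →
    c ≡ e ⊎ Σ (ExitWalk (proj₂ c) e) λ ew′ → ¬ TwoReacher (proj₂ c) × exitLength ew′ < exitLength ew
  cutArc-on-exitWalk (exit yb∈D (inj₁ refl)) c c∈ with c∈ (step yb∈D stop)
  ... | here c≡e = inj₁ c≡e
  cutArc-on-exitWalk (exit yb∈D (inj₂ (p , q , _ , _ , disjoint))) c c∈
    with c∈ (step yb∈D p) | c∈ (step yb∈D q)
  ... | here c≡e | _ = inj₁ c≡e
  ... | there _ | here c≡e = inj₁ c≡e
  ... | there c∈p | there c∈q = ⊥-elim (disjoint c c∈p c∈q)
  cutArc-on-exitWalk (cont {y = y} {w = w} yw∈D ¬w ew) c c∈ with c ≟ᵃ (y , w)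
  ... | yes refl = inj₂ (ew , ¬w , ≤-refl)
  ... | no c≢yw with cutArc-on-exitWalk ew c (λ W → skipFirst (c∈ (step yw∈D W)))
    where
    skipFirst : ∀ {W : Walk D w v} → c ∈ (y , w) ∷ arcs W → c ∈ arcs W
    skipFirst (here c≡yw) = ⊥-elim (c≢yw c≡yw)
    skipFirst (there c∈W) = c∈W
  ...   | inj₁ c≡e = inj₁ c≡e
  ...   | inj₂ (ew′ , ¬c₂ , shorter) = inj₂ (ew′ , ¬c₂ , m<n⇒m<1+n shorter)

  -- The cut arc of y lies on both exit walks: either it is the final arc of both, or both
  -- pass through its head, from where the recursion continues on shorter exit walks.
  exitWalks-agree : ∀ {y e e′} → ¬ TwoReacher y → ExitWalk y e → ExitWalk y e′ → e ≡ e′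
  exitWalks-agree ¬y ew ew′ = byLength _ ¬y ew ew′ ≤-refl
    where
    byLength : ∀ k {y e e′} → ¬ TwoReacher y → (ew : ExitWalk y e) → ExitWalk y e′ →
      exitLength ew < k → e ≡ e′
    byLength (suc k) {y} ¬y ew ew′ (s≤s ew≤k) with twoReaches⊎cutArc D (strong y v)
    ... | inj₁ y∈U = ⊥-elim (¬y y∈U)
    ... | inj₂ (c , c∈) with cutArc-on-exitWalk ew c c∈ | cutArc-on-exitWalk ew′ c c∈
    ...   | inj₁ refl | inj₁ c≡e′ = c≡e′
    ...   | inj₁ refl | inj₂ (_ , ¬c₂ , _) = ⊥-elim (¬c₂ (exitWalk-head ew))
    ...   | inj₂ (_ , ¬c₂ , _) | inj₁ refl = ⊥-elim (¬c₂ (exitWalk-head ew′))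
    ...   | inj₂ (ew₁ , ¬c₂ , shorter) | inj₂ (ew₁′ , _ , _) =
      byLength k ¬c₂ ew₁ ew₁′ (≤-trans shorter ew≤k)

  exitWalks-agree-along : ∀ {G : SimpleGraph n} → IsOrientationOf D G → ∀ {a z e e′} →
    WalkIn G (λ x → ¬ TwoReacher x) a z → ExitWalk a e → ExitWalk z e′ → e ≡ e′
  exitWalks-agree-along orient (here ¬a) ew ew′ = exitWalks-agree ¬a ew ew′
  exitWalks-agree-along orient (there {x = a} {y = b} ¬a ab∈G rest) ew ew′
    with toExitWalk (strong b v) (walkIn-start rest) | proj₁ (proj₂ orient) a b ab∈G
  ... | _ , ewᵇ | inj₁ ab∈D =
    trans (exitWalks-agree ¬a ew (cont ab∈D (walkIn-start rest) ewᵇ))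
          (exitWalks-agree-along orient rest ewᵇ ew′)
  ... | _ , ewᵇ | inj₂ ba∈D =
    trans (exitWalks-agree (walkIn-start rest) (cont ba∈D ¬a ew) ewᵇ)
          (exitWalks-agree-along orient rest ewᵇ ew′)

  ExitArc : (Fin n → Set) → Arc n → Set
  ExitArc C (a , b) = T (D a b) × C a × TwoReacher b

  module _ {G : SimpleGraph n} (orient : IsOrientationOf D G) {C : Fin n → Set}
           (component : IsComponent G (λ x → ¬ TwoReacher x) C) where

    private
      connected = proj₁ (proj₂ (proj₂ component))
      closed = proj₂ (proj₂ (proj₂ component))

    exitWalk⇒exitArc : ∀ {y e} → C y → ExitWalk y e → ExitArc C e
    exitWalk⇒exitArc y∈C (exit yb∈D b∈U) = yb∈D , y∈C , b∈U
    exitWalk⇒exitArc {y} y∈C (cont {w = w} yw∈D ¬w ew) =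
      exitWalk⇒exitArc (closed y w y∈C ¬w (proj₁ orient y w yw∈D)) ew

    exitArc-unique : ∀ {e e′} → ExitArc C e → ExitArc C e′ → e ≡ e′
    exitArc-unique {a , b} {a′ , b′} (ab∈D , a∈C , b∈U) (a′b′∈D , a′∈C , b′∈U) =
      exitWalks-agree-along orient (connected a a′ a∈C a′∈C) (exit ab∈D b∈U) (exit a′b′∈D b′∈U)

lemma3 : ∀ {n : ℕ} (G : SimpleGraph n) (D : Digraph n) →
    IsOrientationOf D G → StronglyConnected D → (v : Fin n) →
    (C : Fin n → Set) → IsComponent G (λ x → ¬ TwoReaches D x v) C →
    Σ (Fin n × Fin n) λ e →
      (T (D (proj₁ e) (proj₂ e)) × C (proj₁ e) × TwoReaches D (proj₂ e) v) ×
      (∀ (e′ : Fin n × Fin n) →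
        T (D (proj₁ e′) (proj₂ e′)) × C (proj₁ e′) × TwoReaches D (proj₂ e′) v →
        e′ ≡ e)
lemma3 G D orient strong v C component@(C⊆S , (x₀ , x₀∈C) , _) =
  let e , ew = toExitWalk (strong x₀ v) (C⊆S x₀ x₀∈C)
      e-exits = exitWalk⇒exitArc orient component x₀∈C ew
  in e , e-exits , λ e′ e′-exits → exitArc-unique orient component e′-exits e-exits
  where open ExitArcs strong v
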